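{- Let $T$ be an $\omega_1$-tree, $n$ a positive integer, $a_0,\ldots,a_{n-1}$ elements of $T$ of the same height, and $U = T_{a_0} \otimes \cdots \otimes T_{a_{n-1}}$. Suppose that $m \le n$, $i_0 < \cdots < i_{m-1} \le n-1$, and $W := T_{a_{i_0}} \otimes \cdots \otimes T_{a_{i_{m-1}}}$ is special. Then $U$ is special.
   Context: An $\omega_1$-tree is a tree of height $\omega_1$ with countable levels. For $a \in T$, $T_a$ is the subtree of all $b \in T$ with $b \le_T a$ or $a \le_T b$. $T_0 \otimes \cdots \otimes T_{k-1}$ is the set of $k$-tuples in $T_0 \times \cdots \times T_{k-1}$ whose entries all have the same height, ordered componentwise. A tree $W$ of height $\omega_1$ is special if there is $f : W \to \omega$ with $f(x) \neq f(y)$ whenever $x <_W y$. -}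

module Defs where

open import Data.Nat using (ℕ)
open import Data.Fin using (Fin; _<_)
open import Data.Product using (Σ; _×_; _,_; proj₁; ∃)
open import Data.Sum using (_⊎_)
open import Data.Empty using (⊥)
open import Relation.Nullary using (¬_)
open import Relation.Binary.PropositionalEquality using (_≡_; _≢_)
open import Function.Definitions using (Injective)
open import Induction.WellFounded using (WellFounded)

Countable : Set → Set
Countable A = Σ (A → ℕ) λ f → Injective _≡_ _≡_ f

-- A model of the ordinal ω₁: an uncountable well-order all of whose
-- proper initial segments are countable (this determines ω₁ up to iso).
record Omega1 : Set₁ where
  field
    Ord      : Set
    _<ₒ_     : Ord → Ord → Set
    irrefl   : ∀ {α} → ¬ (α <ₒ α)
    trans    : ∀ {α β γ} → α <ₒ β → β <ₒ γ → α <ₒ γ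
    trich    : ∀ α β → (α <ₒ β) ⊎ ((α ≡ β) ⊎ (β <ₒ α))
    wf       : WellFounded _<ₒ_
    segCount : ∀ α → Countable (Σ Ord λ β → β <ₒ α)
    uncount  : ¬ Countable Ord

-- An ω₁-tree: a tree whose height function takes values in ω₁,
-- where the height of t is the order type of its predecessors,
-- every level α < ω₁ is nonempty (so the height is ω₁) and countable.
record ω₁Tree (Ω : Omega1) : Set₁ where
  open Omega1 Ω
  field
    Carrier  : Set
    _<ₜ_     : Carrier → Carrier → Set
    irreflₜ  : ∀ {s} → ¬ (s <ₜ s)
    transₜ   : ∀ {r s t} → r <ₜ s → s <ₜ t → r <ₜ t
    predLin  : ∀ {r s t} → r <ₜ t → s <ₜ t → (r <ₜ s) ⊎ ((r ≡ s) ⊎ (s <ₜ r))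
    ht       : Carrier → Ord
    ht-mono  : ∀ {s t} → s <ₜ t → ht s <ₒ ht t
    ht-onto  : ∀ t α → α <ₒ ht t → Σ Carrier λ s → (s <ₜ t) × (ht s ≡ α)
    levelNE  : ∀ α → Σ Carrier λ t → ht t ≡ α
    levelCnt : ∀ α → Countable (Σ Carrier λ t → ht t ≡ α)

module _ {Ω : Omega1} (T : ω₁Tree Ω) where
  open ω₁Tree T

  _≤ₜ_ : Carrier → Carrier → Set
  s ≤ₜ t = (s <ₜ t) ⊎ (s ≡ t)

  InSub : Carrier → Carrier → Set
  InSub a b = (b ≤ₜ a) ⊎ (a ≤ₜ b)

  Prod : (k : ℕ) → (Fin k → Carrier) → Set
  Prod k b = Σ (Fin k → Carrier) λ x →
               (∀ j → InSub (b j) (x j)) × (∀ j l → ht (x j) ≡ ht (x l))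

  _<⊗_ : ∀ {k b} → Prod k b → Prod k b → Set
  x <⊗ y = (∀ j → proj₁ x j ≤ₜ proj₁ y j) × ¬ (∀ j → proj₁ x j ≡ proj₁ y j)

Special : (A : Set) → (A → A → Set) → Set
Special A _<_ = Σ (A → ℕ) λ f → ∀ x y → x < y → f x ≢ f y

module Submission where

-- Restricting a tuple of U to the coordinates i is strictly monotone: if the
-- restrictions agreed, they would agree at one coordinate, so the two tuples
-- would have the same height, and componentwise ≤ at equal heights is equality.
-- A special function on W therefore pulls back to U.

open import Defs
open import Data.Nat using (ℕ; suc; _≤_)
open import Data.Fin using (Fin; _<_; zero)
open import Function using (_∘_)
open import Relation.Binary.PropositionalEquality using (_≡_; sym; trans; cong; subst)
open import Data.Product using (_,_; proj₁)
open import Data.Sum using (inj₁; inj₂)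
open import Data.Empty using (⊥-elim)

Special-pullback : {A B : Set} {_<ᴬ_ : A → A → Set} {_<ᴮ_ : B → B → Set}
  → (g : A → B) → (∀ x y → x <ᴬ y → g x <ᴮ g y)
  → Special B _<ᴮ_ → Special A _<ᴬ_
Special-pullback g g-mono (f , f-special) =
  f ∘ g , λ x y x<y → f-special (g x) (g y) (g-mono x y x<y)

module _ {Ω : Omega1} (T : ω₁Tree Ω) where
  open ω₁Tree T
  open Omega1 Ω using (irrefl; _<ₒ_)

  ≤ₜ∧ht≡⇒≡ : ∀ {s t} → _≤ₜ_ T s t → ht s ≡ ht t → s ≡ t
  ≤ₜ∧ht≡⇒≡ (inj₂ s≡t) _ = s≡t
  ≤ₜ∧ht≡⇒≡ {s} (inj₁ s<t) hs≡ht =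
    ⊥-elim (irrefl (subst (ht s <ₒ_) (sym hs≡ht) (ht-mono s<t)))

  restrict : ∀ {k l} {b : Fin k → Carrier} (i : Fin l → Fin k)
    → Prod T k b → Prod T l (b ∘ i)
  restrict i (x , x∈ , x-ht) = x ∘ i , x∈ ∘ i , λ j l → x-ht (i j) (i l)

  Prod-≤∧≡-at⇒≡ : ∀ {k} {b : Fin k → Carrier} (x y : Prod T k b)
    → (∀ j → _≤ₜ_ T (proj₁ x j) (proj₁ y j))
    → ∀ j₀ → proj₁ x j₀ ≡ proj₁ y j₀ → ∀ j → proj₁ x j ≡ proj₁ y j
  Prod-≤∧≡-at⇒≡ (x , _ , x-ht) (y , _ , y-ht) x≤y j₀ x≡y j =
    ≤ₜ∧ht≡⇒≡ (x≤y j) (trans (x-ht j j₀) (trans (cong ht x≡y) (y-ht j₀ j)))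

  restrict-mono : ∀ {k l} {b : Fin k → Carrier} (i : Fin (suc l) → Fin k)
    → ∀ x y → _<⊗_ T x y → _<⊗_ T (restrict {b = b} i x) (restrict i y)
  restrict-mono i x y (x≤y , x≢y) =
    x≤y ∘ i , λ x|i≡y|i → x≢y (Prod-≤∧≡-at⇒≡ x y x≤y (i zero) (x|i≡y|i zero))

lemma2p7 : (Ω : Omega1) (T : ω₁Tree Ω) (n : ℕ) (a : Fin (suc n) → ω₁Tree.Carrier T)
    → (∀ j l → ω₁Tree.ht T (a j) ≡ ω₁Tree.ht T (a l))
    → (m : ℕ) → suc m ≤ suc n
    → (i : Fin (suc m) → Fin (suc n)) → (∀ {k l} → k < l → i k < i l)
    → Special (Prod T (suc m) (a ∘ i)) (_<⊗_ T)
    → Special (Prod T (suc n) a) (_<⊗_ T)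
lemma2p7 Ω T n a _ m _ i _ = Special-pullback (restrict T i) (restrict-mono T i)
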